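{- Let $I$ be an index set and $\mathcal F$ an ultrafilter on $I$. For each $i\in I$ let $\mathbf X_i=\langle X_i,\le_i\rangle$ be a poset with $X_i\ne\varnothing$, $E_i$ an equivalence relation on $X_i$ with ${\le_i}\subseteq E_i$, and $\alpha_i:X_i\to X_i$ an order automorphism of $\mathbf X_i$ with $\alpha_i\subseteq E_i$. With $Y,\le_Y,E_Y,\alpha_Y$ as in the context: (i) $\mathbf Y=\langle Y,\le_Y\rangle$ is a poset; (ii) $E_Y$ is an equivalence relation on $Y$ with ${\le_Y}\subseteq E_Y$; (iii) $\alpha_Y$ is an order automorphism of $\mathbf Y$ with $\alpha_Y\subseteq E_Y$; (iv) if $0=\alpha_Y\circ(\le_Y)^{c\smile}=(\le_Y)^{c\smile}\circ\alpha_Y$, then $\langle\mathsf{Up}(\langle E_Y,\preceq_Y\rangle),\cap,\cup,\circ,\le_Y,0,{\sim},-\rangle$ is a distributive involutive FL-algebra.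
   Context: Let $X=\prod_{i\in I}X_i$ and for $x,y\in X$ put $(x,y)\in E_{\mathcal F}$ iff $\{i\in I\mid x(i)=y(i)\}\in\mathcal F$; this is an equivalence relation, and $Y=X/E_{\mathcal F}$. Define $[x]\le_Y[y]$ iff $\{i\mid x(i)\le_i y(i)\}\in\mathcal F$, and $([x],[y])\in E_Y$ iff $\{i\mid (x(i),y(i))\in E_i\}\in\mathcal F$. Define $\alpha_Y([x])=[\alpha_X(x)]$ where $(\alpha_X(x))(i)=\alpha_i(x(i))$. Order $E_Y$ by $([u],[v])\preceq_Y([x],[y])$ iff $[x]\le_Y[u]$ and $[v]\le_Y[y]$; $\mathsf{Up}$ denotes the set of upsets. For $R\subseteq E_Y$, $R^c=E_Y\setminus R$, $R^\smile$ is the converse, $\circ$ is relational composition. The operations ${\sim},-$ are the linear negations ${\sim}R=R\backslash0$, $-R=0/R$ with respect to the residuals of $\circ$ on upsets (these equal $R^{c\smile}\circ\alpha_Y$ and $\alpha_Y\circ R^{c\smile}$ respectively). A distributive involutive FL-algebra is a distributive residuated lattice with a distinguished element $0$ whose linear negations ${\sim}a=a\backslash0$, $-a=0/a$ satisfy $-{\sim}a=a={\sim}{ - }a$. -}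

module Defs where

open import Level using (Level; _⊔_; suc; Lift)
open import Data.Empty using (⊥)
open import Data.Unit using (⊤)
open import Data.Product using (Σ; ∃; _×_; _,_)
open import Data.Sum using (_⊎_)
open import Relation.Nullary using (¬_)
open import Relation.Unary using (Pred; _⊆_; _∩_; ∁)
open import Relation.Binary using (Rel; IsEquivalence; IsPartialOrder)
open import Relation.Binary.PropositionalEquality using (_≡_)
open import Algebra.Core using (Op₂)
open import Algebra.Structures using (IsMonoid)
open import Algebra.Lattice.Structures using (IsDistributiveLattice)

record IsUltrafilter {ℓ : Level} {I : Set ℓ} (F : Pred (Pred I ℓ) ℓ) : Set (suc ℓ) where
  field
    upward : ∀ {A B : Pred I ℓ} → A ⊆ B → F A → F B
    inter  : ∀ {A B : Pred I ℓ} → F A → F B → F (A ∩ B)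
    whole  : F (λ _ → Lift ℓ ⊤)
    proper : ¬ F (λ _ → Lift ℓ ⊥)
    ultra  : ∀ (A : Pred I ℓ) → F A ⊎ F (∁ A)

record IsOrderAutomorphism {a ℓ₁ ℓ₂ : Level} {A : Set a}
       (_≈_ : Rel A ℓ₁) (_≤_ : Rel A ℓ₂) (f : A → A) : Set (a ⊔ ℓ₁ ⊔ ℓ₂) where
  field
    cong       : ∀ {x y} → x ≈ y → f x ≈ f y
    injective  : ∀ {x y} → f x ≈ f y → x ≈ y
    surjective : ∀ y → ∃ λ x → f x ≈ y
    monotone   : ∀ {x y} → x ≤ y → f x ≤ f y
    reflecting : ∀ {x y} → f x ≤ f y → x ≤ y

module _ {c ℓ : Level} {A : Set c} (_≈_ : Rel A ℓ) (_∧_ : Op₂ A) where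
  LatLeq : Rel A ℓ
  LatLeq a b = (a ∧ b) ≈ a

record IsDistributiveInvolutiveFLAlgebra {c ℓ : Level} {A : Set c} (_≈_ : Rel A ℓ)
       (_∧_ _∨_ _·_ : Op₂ A) (e 0# : A) : Set (c ⊔ ℓ) where
  _≤_ : Rel A ℓ
  _≤_ = LatLeq _≈_ _∧_
  field
    isDistributiveLattice : IsDistributiveLattice _≈_ _∨_ _∧_
    ·-isMonoid            : IsMonoid _≈_ _·_ e
    _\\_ _//_             : Op₂ A
    residual-\\ : ∀ a b d → ((a · b) ≤ d → b ≤ (a \\ d)) × (b ≤ (a \\ d) → (a · b) ≤ d)
    residual-// : ∀ a b d → ((a · b) ≤ d → a ≤ (d // b)) × (a ≤ (d // b) → (a · b) ≤ d)
  ~_ : A → A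
  ~ a = a \\ 0#
  -_ : A → A
  - a = 0# // a
  field
    involutive : ∀ a → ((- (~ a)) ≈ a) × ((~ (- a)) ≈ a)

-- The ultraproduct construction.  The quotient Y = X / E_F is represented
-- as the product type Π with the setoid equality _≈F_.

module Ultraproduct {ℓ : Level} (I : Set ℓ) (F : Pred (Pred I ℓ) ℓ)
  (X : I → Set ℓ) (Le : ∀ i → Rel (X i) ℓ)
  (E : ∀ i → Rel (X i) ℓ) (α : ∀ i → X i → X i) where

  Π : Set ℓ
  Π = (i : I) → X i

  _≈F_ : Rel Π ℓ
  x ≈F y = F (λ i → x i ≡ y i)

  _≤Y_ : Rel Π ℓ
  x ≤Y y = F (λ i → Le i (x i) (y i))

  EY : Rel Π ℓ
  EY x y = F (λ i → E i (x i) (y i))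

  αY : Π → Π
  αY x i = α i (x i)

  αrel : Rel Π ℓ
  αrel x y = αY x ≈F y

  _∘r_ : Rel Π ℓ → Rel Π ℓ → Rel Π ℓ
  (R ∘r S) x y = ∃ λ z → R x z × S z y

  -- (≤_Y)^{c⌣}, complement taken inside E_Y
  ≤Ycᵒ : Rel Π ℓ
  ≤Ycᵒ x y = EY y x × ¬ (y ≤Y x)

  -- up-sets of ⟨E_Y, ⪯_Y⟩, where (u,v) ⪯ (x,y) iff x ≤ u and v ≤ y
  record Up : Set (suc ℓ) where
    field
      rel    : Rel Π ℓ
      inE    : ∀ {x y} → rel x y → EY x y
      upward : ∀ {u v x y} → rel u v → x ≤Y u → v ≤Y y → rel x y
  open Up public

  _≐_ : Rel Up ℓ
  R ≐ S = (∀ x y → rel R x y → rel S x y) × (∀ x y → rel S x y → rel R x y)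

  _≐r_ : Rel (Rel Π ℓ) ℓ
  R ≐r S = ∀ x y → (R x y → S x y) × (S x y → R x y)

  _∩Up_ : Op₂ Up
  R ∩Up S = record
    { rel    = λ x y → rel R x y × rel S x y
    ; inE    = λ { (r , _) → inE R r }
    ; upward = λ { (r , s) p q → upward R r p q , upward S s p q } }

  _∪Up_ : Op₂ Up
  R ∪Up S = record
    { rel    = λ x y → rel R x y ⊎ rel S x y
    ; inE    = λ { (Data.Sum.inj₁ r) → inE R r ; (Data.Sum.inj₂ s) → inE S s }
    ; upward = λ { (Data.Sum.inj₁ r) p q → Data.Sum.inj₁ (upward R r p q)
                 ; (Data.Sum.inj₂ s) p q → Data.Sum.inj₂ (upward S s p q) } }

-- Parts (i)–(iii) are universal Horn properties of the factors, and a filter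
-- is closed under finite intersections and supersets, so each of them passes
-- from "for all i" to "for F-many i", i.e. to the ultraproduct.
--
-- For (iv), up-sets of ⟨E_Y, ⪯_Y⟩ under composition form a residuated lattice
-- with unit ≤_Y, the residuals being R \ T = {(x,y) ∈ E_Y | ∀ z. z R x → z T y}
-- and symmetrically for /. The element 0 = α ∘ (≤)^{c⌣} relates x to y exactly
-- when x E y and y ≰ α x. Involutivity is then proved classically: if x R y
-- fails, the pair (y, α x) lies in ~R, which forces (x, α x) ∈ 0, i.e.
-- α x ≰ α x; dually, (α⁻¹ y, x) ∈ -R forces y ≰ y.
module Submission where

open import Defs
open import Level using (Level)
open import Data.Product using (Σ; _×_; _,_; proj₁; proj₂)
open import Data.Sum using (inj₁; inj₂; swap)
open import Function using (id)
open import Relation.Unary using (Pred)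
open import Relation.Binary using (Rel; IsEquivalence; IsPartialOrder)
open import Relation.Binary.PropositionalEquality as ≡ using (_≡_)
open import Relation.Nullary using (¬_)
open import Relation.Nullary.Decidable using (decidable-stable)
open import Axiom.ExcludedMiddle using (ExcludedMiddle)
open import Algebra.Structures using (IsMonoid)
open import Algebra.Lattice.Structures using (IsDistributiveLattice)

module FilterLemmas {ℓ : Level} {I : Set ℓ} {F : Pred (Pred I ℓ) ℓ}
                    (isUltrafilter : IsUltrafilter F) where

  open IsUltrafilter isUltrafilter

  F-all : {A : Pred I ℓ} → (∀ i → A i) → F A
  F-all f = upward (λ {i} _ → f i) whole

  F-zipWith : {A B C : Pred I ℓ} → (∀ {i} → A i → B i → C i) → F A → F B → F C
  F-zipWith f a b = upward (λ (p , q) → f p q) (inter a b)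

module UltraproductStructure {ℓ : Level}
    (I : Set ℓ) (F : Pred (Pred I ℓ) ℓ) (isUltrafilter : IsUltrafilter F)
    (X : I → Set ℓ) (Le : ∀ i → Rel (X i) ℓ) (E : ∀ i → Rel (X i) ℓ) (α : ∀ i → X i → X i)
    (Le-isPartialOrder : ∀ i → IsPartialOrder _≡_ (Le i))
    (E-isEquivalence : ∀ i → IsEquivalence (E i))
    (Le⇒E : ∀ i {x y} → Le i x y → E i x y)
    (α-isOrderAutomorphism : ∀ i → IsOrderAutomorphism _≡_ (Le i) (α i))
    (α⊆E : ∀ i x → E i x (α i x)) where

  open Ultraproduct I F X Le E α
  open IsUltrafilter isUltrafilter using () renaming (upward to F-upward)
  open FilterLemmas isUltrafilter
  module Le i = IsPartialOrder (Le-isPartialOrder i)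
  module E i = IsEquivalence (E-isEquivalence i)
  module α i = IsOrderAutomorphism (α-isOrderAutomorphism i)

  ≈F-isEquivalence : IsEquivalence _≈F_
  ≈F-isEquivalence = record
    { refl  = F-all (λ _ → ≡.refl)
    ; sym   = F-upward ≡.sym
    ; trans = F-zipWith ≡.trans
    }

  ≤Y-isPartialOrder : IsPartialOrder _≈F_ _≤Y_
  ≤Y-isPartialOrder = record
    { isPreorder = record
      { isEquivalence = ≈F-isEquivalence
      ; reflexive     = F-upward (λ {i} → Le.reflexive i)
      ; trans         = F-zipWith (λ {i} → Le.trans i)
      }
    ; antisym = F-zipWith (λ {i} → Le.antisym i)
    }

  EY-isEquivalence : IsEquivalence EY
  EY-isEquivalence = record
    { refl  = F-all (λ i → E.refl i)
    ; sym   = F-upward (λ {i} → E.sym i)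
    ; trans = F-zipWith (λ {i} → E.trans i)
    }

  ≤Y⇒EY : ∀ {x y} → x ≤Y y → EY x y
  ≤Y⇒EY = F-upward (λ {i} → Le⇒E i)

  αY-isOrderAutomorphism : IsOrderAutomorphism _≈F_ _≤Y_ αY
  αY-isOrderAutomorphism = record
    { cong       = F-upward (λ {i} → α.cong i)
    ; injective  = F-upward (λ {i} → α.injective i)
    ; surjective = λ y → (λ i → proj₁ (α.surjective i (y i)))
                       , F-all (λ i → proj₂ (α.surjective i (y i)))
    ; monotone   = F-upward (λ {i} → α.monotone i)
    ; reflecting = F-upward (λ {i} → α.reflecting i)
    }

  αY⊆EY : ∀ x → EY x (αY x)
  αY⊆EY x = F-all (λ i → α⊆E i (x i))

module UpSetAlgebra {ℓ : Level}
    (I : Set ℓ) (F : Pred (Pred I ℓ) ℓ)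
    (X : I → Set ℓ) (Le : ∀ i → Rel (X i) ℓ) (E : ∀ i → Rel (X i) ℓ) (α : ∀ i → X i → X i) where

  open Ultraproduct I F X Le E α

  ≐r-refl : {R : Rel Π ℓ} → R ≐r R
  ≐r-refl _ _ = id , id

  module FLAlgebra (em : ExcludedMiddle ℓ)
      (≤Y-isPartialOrder : IsPartialOrder _≈F_ _≤Y_)
      (EY-isEquivalence : IsEquivalence EY)
      (≤Y⇒EY : ∀ {x y} → x ≤Y y → EY x y)
      (αY-isOrderAutomorphism : IsOrderAutomorphism _≈F_ _≤Y_ αY)
      (αY⊆EY : ∀ x → EY x (αY x)) where

    open IsPartialOrder ≤Y-isPartialOrder
      using () renaming (refl to ≤-refl; trans to ≤-trans; reflexive to ≈⇒≤)
    open IsEquivalence (IsPartialOrder.isEquivalence ≤Y-isPartialOrder)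
      using () renaming (refl to ≈F-refl; sym to ≈F-sym)
    open IsEquivalence EY-isEquivalence
      using () renaming (sym to E-sym; trans to E-trans)
    open IsOrderAutomorphism αY-isOrderAutomorphism using (monotone; reflecting; surjective)

    ≈⇒EY : ∀ {x y} → x ≈F y → EY x y
    ≈⇒EY p = ≤Y⇒EY (≈⇒≤ p)

    ≐-isEquivalence : IsEquivalence _≐_
    ≐-isEquivalence = record
      { refl  = (λ _ _ → id) , (λ _ _ → id)
      ; sym   = λ (f , g) → g , f
      ; trans = λ (f , g) (f′ , g′) → (λ x y r → f′ x y (f x y r)) , (λ x y r → g x y (g′ x y r))
      }

    ⊆⇒≐ : ∀ {R S} → (∀ {x y} → rel R x y → rel S x y) → (∀ {x y} → rel S x y → rel R x y) → R ≐ S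
    ⊆⇒≐ f g = (λ _ _ → f) , (λ _ _ → g)

    _≤Up_ : Rel Up ℓ
    _≤Up_ = LatLeq _≐_ _∩Up_

    ⊆⇒≤Up : ∀ {R S} → (∀ {x y} → rel R x y → rel S x y) → R ≤Up S
    ⊆⇒≤Up f = (λ _ _ → proj₁) , (λ _ _ r → r , f r)

    ≤Up⇒⊆ : ∀ {R S} → R ≤Up S → ∀ {x y} → rel R x y → rel S x y
    ≤Up⇒⊆ (_ , g) r = proj₂ (g _ _ r)

    ∩Up-∪Up-isDistributiveLattice : IsDistributiveLattice _≐_ _∪Up_ _∩Up_
    ∩Up-∪Up-isDistributiveLattice = record
      { isLattice = record
        { isEquivalence = ≐-isEquivalence
        ; ∨-comm = λ R S → ⊆⇒≐ {R ∪Up S} {S ∪Up R} swap swap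
        ; ∨-assoc = λ R S T → ⊆⇒≐ {(R ∪Up S) ∪Up T} {R ∪Up (S ∪Up T)}
            (λ { (inj₁ (inj₁ r)) → inj₁ r ; (inj₁ (inj₂ s)) → inj₂ (inj₁ s) ; (inj₂ t) → inj₂ (inj₂ t) })
            (λ { (inj₁ r) → inj₁ (inj₁ r) ; (inj₂ (inj₁ s)) → inj₁ (inj₂ s) ; (inj₂ (inj₂ t)) → inj₂ t })
        ; ∨-cong = λ (f , g) (f′ , g′) →
            (λ { x y (inj₁ r) → inj₁ (f x y r) ; x y (inj₂ s) → inj₂ (f′ x y s) }) ,
            (λ { x y (inj₁ r) → inj₁ (g x y r) ; x y (inj₂ s) → inj₂ (g′ x y s) })
        ; ∧-comm = λ R S → ⊆⇒≐ {R ∩Up S} {S ∩Up R} (λ (r , s) → s , r) (λ (s , r) → r , s)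
        ; ∧-assoc = λ R S T → ⊆⇒≐ {(R ∩Up S) ∩Up T} {R ∩Up (S ∩Up T)}
            (λ ((r , s) , t) → r , s , t) (λ (r , s , t) → (r , s) , t)
        ; ∧-cong = λ (f , g) (f′ , g′) →
            (λ x y (r , s) → f x y r , f′ x y s) , (λ x y (r , s) → g x y r , g′ x y s)
        ; absorptive =
            (λ R S → ⊆⇒≐ {R ∪Up (R ∩Up S)} {R} (λ { (inj₁ r) → r ; (inj₂ (r , _)) → r }) inj₁)
          , (λ R S → ⊆⇒≐ {R ∩Up (R ∪Up S)} {R} proj₁ (λ r → r , inj₁ r))
        }
      ; ∨-distrib-∧ =
          (λ R S T → ⊆⇒≐ {R ∪Up (S ∩Up T)} {(R ∪Up S) ∩Up (R ∪Up T)}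
            (λ { (inj₁ r) → inj₁ r , inj₁ r ; (inj₂ (s , t)) → inj₂ s , inj₂ t })
            (λ { (inj₁ r , _) → inj₁ r ; (inj₂ _ , inj₁ r) → inj₁ r ; (inj₂ s , inj₂ t) → inj₂ (s , t) }))
        , (λ R S T → ⊆⇒≐ {(S ∩Up T) ∪Up R} {(S ∪Up R) ∩Up (T ∪Up R)}
            (λ { (inj₁ (s , t)) → inj₁ s , inj₁ t ; (inj₂ r) → inj₂ r , inj₂ r })
            (λ { (_ , inj₂ r) → inj₂ r ; (inj₂ r , inj₁ _) → inj₂ r ; (inj₁ s , inj₁ t) → inj₁ (s , t) }))
      ; ∧-distrib-∨ =
          (λ R S T → ⊆⇒≐ {R ∩Up (S ∪Up T)} {(R ∩Up S) ∪Up (R ∩Up T)}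
            (λ { (r , inj₁ s) → inj₁ (r , s) ; (r , inj₂ t) → inj₂ (r , t) })
            (λ { (inj₁ (r , s)) → r , inj₁ s ; (inj₂ (r , t)) → r , inj₂ t }))
        , (λ R S T → ⊆⇒≐ {(S ∪Up T) ∩Up R} {(S ∩Up R) ∪Up (T ∩Up R)}
            (λ { (inj₁ s , r) → inj₁ (s , r) ; (inj₂ t , r) → inj₂ (t , r) })
            (λ { (inj₁ (s , r)) → inj₁ s , r ; (inj₂ (t , r)) → inj₂ t , r }))
      }

    _⊙_ : Up → Up → Up
    R ⊙ S = record
      { rel    = rel R ∘r rel S
      ; inE    = λ (_ , r , s) → E-trans (inE R r) (inE S s)
      ; upward = λ (z , r , s) p q → z , upward R r p ≤-refl , upward S s ≤-refl q
      }

    oneUp : Up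
    oneUp = record { rel = _≤Y_ ; inE = ≤Y⇒EY ; upward = λ r p q → ≤-trans p (≤-trans r q) }

    ⊙-isMonoid : IsMonoid _≐_ _⊙_ oneUp
    ⊙-isMonoid = record
      { isSemigroup = record
        { isMagma = record
          { isEquivalence = ≐-isEquivalence
          ; ∙-cong = λ (f , g) (f′ , g′) →
              (λ x y (z , r , s) → z , f x z r , f′ z y s) ,
              (λ x y (z , r , s) → z , g x z r , g′ z y s)
          }
        ; assoc = λ R S T → ⊆⇒≐ {(R ⊙ S) ⊙ T} {R ⊙ (S ⊙ T)}
            (λ (z , (w , r , s) , t) → w , r , z , s , t)
            (λ (w , r , z , s , t) → z , (w , r , s) , t)
        }
      ; identity =
          (λ R → ⊆⇒≐ {oneUp ⊙ R} {R} (λ (_ , p , r) → upward R r p ≤-refl) (λ r → _ , ≤-refl , r))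
        , (λ R → ⊆⇒≐ {R ⊙ oneUp} {R} (λ (_ , r , p) → upward R r ≤-refl p) (λ r → _ , r , ≤-refl))
      }

    _\\Up_ : Up → Up → Up
    R \\Up T = record
      { rel    = λ x y → EY x y × (∀ z → rel R z x → rel T z y)
      ; inE    = proj₁
      ; upward = λ (e , h) p q → E-trans (≤Y⇒EY p) (E-trans e (≤Y⇒EY q))
                               , λ z r → upward T (h z (upward R r ≤-refl p)) ≤-refl q
      }

    _//Up_ : Up → Up → Up
    T //Up S = record
      { rel    = λ x y → EY x y × (∀ z → rel S y z → rel T x z)
      ; inE    = proj₁
      ; upward = λ (e , h) p q → E-trans (≤Y⇒EY p) (E-trans e (≤Y⇒EY q))
                               , λ z s → upward T (h z (upward S s q ≤-refl)) p ≤-refl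
      }

    \\Up-residual : ∀ R S T → ((R ⊙ S) ≤Up T → S ≤Up (R \\Up T)) × (S ≤Up (R \\Up T) → (R ⊙ S) ≤Up T)
    \\Up-residual R S T =
        (λ RS≤T → ⊆⇒≤Up {S} {R \\Up T}
          (λ {x} s → inE S s , λ z r → ≤Up⇒⊆ {R ⊙ S} {T} RS≤T (x , r , s)))
      , (λ S≤R\\T → ⊆⇒≤Up {R ⊙ S} {T}
          (λ (z , r , s) → proj₂ (≤Up⇒⊆ {S} {R \\Up T} S≤R\\T s) _ r))

    //Up-residual : ∀ R S T → ((R ⊙ S) ≤Up T → R ≤Up (T //Up S)) × (R ≤Up (T //Up S) → (R ⊙ S) ≤Up T)
    //Up-residual R S T =
        (λ RS≤T → ⊆⇒≤Up {R} {T //Up S}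
          (λ {_} {y} r → inE R r , λ z s → ≤Up⇒⊆ {R ⊙ S} {T} RS≤T (y , r , s)))
      , (λ R≤T//S → ⊆⇒≤Up {R ⊙ S} {T}
          (λ (z , r , s) → proj₂ (≤Up⇒⊆ {R} {T //Up S} R≤T//S r) _ s))

    zero-intro : ∀ {x y} → EY x y → ¬ (y ≤Y αY x) → (αrel ∘r ≤Ycᵒ) x y
    zero-intro {x} e y≰αx = αY x , ≈F-refl , E-trans (E-sym e) (αY⊆EY x) , y≰αx

    zero-elim : ∀ {x y} → (αrel ∘r ≤Ycᵒ) x y → EY x y × ¬ (y ≤Y αY x)
    zero-elim {x} (z , αx≈z , e , y≰z) =
      E-trans (αY⊆EY x) (E-trans (≈⇒EY αx≈z) (E-sym e)) , λ y≤αx → y≰z (≤-trans y≤αx (≈⇒≤ αx≈z))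

    zeroUp : Up
    zeroUp = record
      { rel    = αrel ∘r ≤Ycᵒ
      ; inE    = λ o → proj₁ (zero-elim o)
      ; upward = λ o x≤u v≤y →
          let (e , v≰αu) = zero-elim o in
          zero-intro (E-trans (≤Y⇒EY x≤u) (E-trans e (≤Y⇒EY v≤y)))
                     (λ y≤αx → v≰αu (≤-trans v≤y (≤-trans y≤αx (monotone x≤u))))
      }

    ~Up_ -Up_ : Up → Up
    ~Up R = R \\Up zeroUp
    -Up R = zeroUp //Up R

    ⊆-Up~Up : ∀ R {x y} → rel R x y → rel (-Up (~Up R)) x y
    ⊆-Up~Up R r = inE R r , λ _ h → proj₂ h _ r

    ⊆~Up-Up : ∀ R {x y} → rel R x y → rel (~Up (-Up R)) x y
    ⊆~Up-Up R r = inE R r , λ _ h → proj₂ h _ r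

    -Up~Up⊆ : ∀ R {x y} → rel (-Up (~Up R)) x y → rel R x y
    -Up~Up⊆ R {x} {y} (e , h) = decidable-stable em λ ¬r →
      let y,αx∈~R : rel (~Up R) y (αY x)
          y,αx∈~R = E-trans (E-sym e) (αY⊆EY x)
                  , λ w r → zero-intro (E-trans (inE R r) (E-trans (E-sym e) (αY⊆EY x)))
                                       (λ αx≤αw → ¬r (upward R r (reflecting αx≤αw) ≤-refl))
      in proj₂ (zero-elim (h (αY x) y,αx∈~R)) ≤-refl

    ~Up-Up⊆ : ∀ R {x y} → rel (~Up (-Up R)) x y → rel R x y
    ~Up-Up⊆ R {x} {y} (e , h) = decidable-stable em λ ¬r →
      let (x′ , αx′≈y) = surjective y
          x′,x∈-R : rel (-Up R) x′ x
          x′,x∈-R = E-trans (αY⊆EY x′) (E-trans (≈⇒EY αx′≈y) (E-sym e))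
                  , λ w r → zero-intro (E-trans (αY⊆EY x′) (E-trans (≈⇒EY αx′≈y) (E-trans (E-sym e) (inE R r))))
                                       (λ w≤αx′ → ¬r (upward R r ≤-refl (≤-trans w≤αx′ (≈⇒≤ αx′≈y))))
      in proj₂ (zero-elim (h x′ x′,x∈-R)) (≈⇒≤ (≈F-sym αx′≈y))

    isDistributiveInvolutiveFLAlgebra : IsDistributiveInvolutiveFLAlgebra _≐_ _∩Up_ _∪Up_ _⊙_ oneUp zeroUp
    isDistributiveInvolutiveFLAlgebra = record
      { isDistributiveLattice = ∩Up-∪Up-isDistributiveLattice
      ; ·-isMonoid            = ⊙-isMonoid
      ; _\\_                  = _\\Up_
      ; _//_                  = _//Up_
      ; residual-\\           = \\Up-residual
      ; residual-//           = //Up-residual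
      ; involutive            = λ R → ⊆⇒≐ { -Up (~Up R)} {R} (-Up~Up⊆ R) (⊆-Up~Up R)
                                    , ⊆⇒≐ {~Up (-Up R)} {R} (~Up-Up⊆ R) (⊆~Up-Up R)
      }

theorem4p5 : {ℓ : Level} → ExcludedMiddle ℓ →
    (I : Set ℓ) (F : Pred (Pred I ℓ) ℓ) → IsUltrafilter F →
    (X : I → Set ℓ) (Le : ∀ i → Rel (X i) ℓ) (E : ∀ i → Rel (X i) ℓ) (α : ∀ i → X i → X i) →
    (∀ i → X i) →
    (∀ i → IsPartialOrder _≡_ (Le i)) →
    (∀ i → IsEquivalence (E i)) →
    (∀ i {x y} → Le i x y → E i x y) →
    (∀ i → IsOrderAutomorphism _≡_ (Le i) (α i)) →
    (∀ i x → E i x (α i x)) →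
    let open Ultraproduct I F X Le E α in
      IsPartialOrder _≈F_ _≤Y_
    × (IsEquivalence EY × (∀ {x y} → x ≤Y y → EY x y))
    × (IsOrderAutomorphism _≈F_ _≤Y_ αY × (∀ x → EY x (αY x)))
    × ((αrel ∘r ≤Ycᵒ) ≐r (≤Ycᵒ ∘r αrel) →
        Σ (Up → Up → Up) λ _⊙_ →
        Σ Up λ one →
        Σ Up λ zero →
          (∀ R S → rel (R ⊙ S) ≐r (rel R ∘r rel S))
        × (rel one ≐r _≤Y_)
        × (rel zero ≐r (αrel ∘r ≤Ycᵒ))
        × IsDistributiveInvolutiveFLAlgebra _≐_ _∩Up_ _∪Up_ _⊙_ one zero)
theorem4p5 em I F isUltrafilter X Le E α _ Le-po E-eq Le⇒E α-aut α⊆E =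
    ≤Y-isPartialOrder
  , (EY-isEquivalence , ≤Y⇒EY)
  , (αY-isOrderAutomorphism , αY⊆EY)
  , λ _ → _⊙_ , oneUp , zeroUp
        , (λ _ _ → ≐r-refl) , ≐r-refl , ≐r-refl
        , isDistributiveInvolutiveFLAlgebra
  where
  open UltraproductStructure I F isUltrafilter X Le E α Le-po E-eq Le⇒E α-aut α⊆E
  open UpSetAlgebra I F X Le E α
  open FLAlgebra em ≤Y-isPartialOrder EY-isEquivalence ≤Y⇒EY αY-isOrderAutomorphism αY⊆EY
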